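{- The following graphs are veto interval graphs: (1) the complete bipartite graphs $K_{m,n}$ for all integers $m \geq 1$, $n \geq 1$; (2) the cycles $C_n$ for all $n \geq 4$; (3) all (finite) trees.
   Context: All graphs are finite and simple. A veto interval is a triple $I(a)=(a_l,a_v,a_r)$ of real numbers with $a_l<a_v<a_r$; it consists of the closed interval $[a_l,a_r]$ together with the veto mark $a_v$. A veto interval representation of a graph $G$ assigns to each vertex $a$ of $G$ a veto interval $I(a)$ such that two distinct vertices $a,b$ are adjacent if and only if $a_v<b_l<a_r<b_v$ or $b_v<a_l<b_r<a_v$ (i.e. the intervals intersect and neither contains the veto mark of the other). A graph is a veto interval (VI) graph if it has a veto interval representation. -}

module Defs where

open import Data.Nat using (ℕ; zero; suc; _+_; _∸_; _≤_; _<_)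
open import Data.Fin using (Fin; toℕ)
open import Data.Rational using (ℚ) renaming (_<_ to _<ℚ_)
open import Data.List using (List; []; _∷_; _++_; [_]; length)
open import Data.List.Relation.Unary.Unique.Propositional using (Unique)
open import Data.Product using (Σ; ∃; _×_; _,_)
open import Data.Sum using (_⊎_)
open import Data.Unit using (⊤)
open import Relation.Nullary using (¬_)
open import Relation.Binary.PropositionalEquality using (_≡_; _≢_)

record Graph (n : ℕ) : Set₁ where
  field
    Adj     : Fin n → Fin n → Set
    symAdj  : ∀ {a b} → Adj a b → Adj b a
    irrefl  : ∀ {a} → ¬ Adj a a
open Graph public

-- Veto intervals (endpoints rational; only the order of the finitely
-- many endpoints matters)

record VetoInterval : Set where
  constructor veto
  field
    l v r : ℚ
    l<v   : l <ℚ v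
    v<r   : v <ℚ r
open VetoInterval public

VetoAdj : VetoInterval → VetoInterval → Set
VetoAdj A B =
  (v A <ℚ l B × l B <ℚ r A × r A <ℚ v B) ⊎
  (v B <ℚ l A × l A <ℚ r B × r B <ℚ v A)

IsVetoRepresentation : ∀ {n} → Graph n → (Fin n → VetoInterval) → Set
IsVetoRepresentation G I =
  ∀ a b → a ≢ b →
    (Adj G a b → VetoAdj (I a) (I b)) × (VetoAdj (I a) (I b) → Adj G a b)

IsVIGraph : ∀ {n} → Graph n → Set
IsVIGraph {n} G = Σ (Fin n → VetoInterval) λ I → IsVetoRepresentation G I

KAdj : (m k : ℕ) → Fin (m + k) → Fin (m + k) → Set
KAdj m k a b = (toℕ a < m × m ≤ toℕ b) ⊎ (toℕ b < m × m ≤ toℕ a)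

CompleteBipartite : (m k : ℕ) → Graph (m + k)
CompleteBipartite m k = record
  { Adj = KAdj m k ; symAdj = sym' ; irrefl = irr }
  where
  open import Data.Sum using (inj₁; inj₂)
  open import Data.Nat.Properties using (<-irrefl; ≤-<-trans)
  open import Relation.Binary.PropositionalEquality using (refl)
  sym' : ∀ {a b} → KAdj m k a b → KAdj m k b a
  sym' (inj₁ p) = inj₂ p
  sym' (inj₂ p) = inj₁ p
  irr : ∀ {a} → ¬ KAdj m k a a
  irr (inj₁ (p , q)) = <-irrefl refl (≤-<-trans q p)
  irr (inj₂ (p , q)) = <-irrefl refl (≤-<-trans q p)

CStep : (n : ℕ) → Fin n → Fin n → Set
CStep n a b = (toℕ b ≡ suc (toℕ a)) ⊎ (toℕ a ≡ 0 × toℕ b ≡ n ∸ 1)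

CAdj : (n : ℕ) → Fin n → Fin n → Set
CAdj n a b = (a ≢ b) × (CStep n a b ⊎ CStep n b a)

Cycle : (n : ℕ) → Graph n
Cycle n = record { Adj = CAdj n ; symAdj = sym' ; irrefl = irr }
  where
  open import Data.Sum using (inj₁; inj₂)
  open import Relation.Binary.PropositionalEquality using (refl; sym)
  sym' : ∀ {a b} → CAdj n a b → CAdj n b a
  sym' (ne , inj₁ p) = (λ e → ne (sym e)) , inj₂ p
  sym' (ne , inj₂ p) = (λ e → ne (sym e)) , inj₁ p
  irr : ∀ {a} → ¬ CAdj n a a
  irr (ne , _) = ne refl

module _ {n : ℕ} (G : Graph n) where

  data Walk : Fin n → Fin n → Set where
    stop : ∀ {a} → Walk a a
    step : ∀ {a b c} → Adj G a b → Walk b c → Walk a c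

  Connected : Set
  Connected = ∀ a b → Walk a b

  Linked : List (Fin n) → Set
  Linked []           = ⊤
  Linked (x ∷ [])     = ⊤
  Linked (x ∷ y ∷ xs) = Adj G x y × Linked (y ∷ xs)

  -- a cycle: distinct vertices x, x₁, …, xₖ (k ≥ 2, so at least 3
  -- vertices) with consecutive ones adjacent and xₖ adjacent to x
  HasCycle : Set
  HasCycle = Σ (Fin n) λ x → Σ (List (Fin n)) λ xs →
    (2 ≤ length xs) × Unique (x ∷ xs) × Linked (x ∷ xs ++ [ x ])

  IsTree : Set
  IsTree = Connected × ¬ HasCycle

-- Only the relative order of the endpoints matters, so natural-number endpoints
-- suffice.
--
-- K_{m,k}: every vertex of the first side gets [0,3] with veto 1, every vertex of
-- the second side [2,5] with veto 4; equal intervals never cross.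
--
-- C_n: vertex i ≥ 1 gets [4i, 4i+5] with veto 4i+2, so consecutive vertices cross
-- and the others are disjoint; vertex 0 gets [7, 4(n-1)+1] with veto 10, which
-- crosses the intervals of 1 and n-1 and contains all the others.
--
-- Trees: root the tree, and write numbers in base K = 3|V| as (high, low) digits.
-- A vertex x with parent p at depth d gets the interval from (d, 3p) to
-- (d+1, 3x+1) with veto (d, 3p+2). The left end and veto of every child of x lie
-- just around the right end (d+1, 3x+1) of x, so parent and child cross. Conversely,
-- if a crosses b, the right end of a is the successor of the left end of b, which
-- pins down the depth and the parent of b. Acyclicity makes every edge a parent edge.
module Submission where

open import Defs
open import Level using (0ℓ)
open import Function using (_∘_; id; const)
open import Data.Bool using (Bool; true; false)
open import Data.Empty using (⊥-elim)
open import Data.Unit using (tt)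
open import Data.Nat using (ℕ; zero; suc; _+_; _*_; _≤_; _<_; z≤n; s≤s; s≤s⁻¹; z<s; _<?_)
open import Data.Nat.Properties
open import Data.Nat.Coprimality using (1-coprimeTo) renaming (sym to coprime-sym)
open import Data.Integer as ℤ using (+_)
import Data.Integer.Properties as ℤ
open import Data.Rational using (ℚ; mkℚ; *<*) renaming (_<_ to _<ℚ_)
open import Data.Fin using (Fin; toℕ) renaming (zero to fzero)
open import Data.Fin.Properties using (toℕ<n; toℕ-injective) renaming (_≟_ to _≟ᶠ_)
open import Data.Vec.Functional using (updateAt)
open import Data.Vec.Functional.Properties using (updateAt-updates; updateAt-minimal)
open import Data.List using (List; []; _∷_; _++_; [_]; length; allFin)
open import Data.List.Membership.Propositional using (_∈_)
open import Data.List.Membership.Propositional.Properties using (∈-allFin)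
open import Data.List.Relation.Unary.Any using (here; there)
import Data.List.Relation.Unary.All as All
open import Data.List.Relation.Unary.All.Properties.Core using (¬Any⇒All¬)
import Data.List.Relation.Unary.AllPairs as AllPairs
open import Data.List.Relation.Unary.Unique.Propositional using (Unique)
open import Data.Product using (Σ; _×_; _,_; proj₁; proj₂)
open import Data.Sum using (_⊎_; inj₁; inj₂; swap)
import Data.Sum as Sum
open import Relation.Nullary using (¬_; Dec; yes; no; contradiction)
open import Relation.Binary using (Rel; DecidableEquality)
open import Relation.Binary.Construct.Closure.ReflexiveTransitive using (Star; ε; _◅_; _◅◅_; reverse)
open import Relation.Binary.PropositionalEquality hiding ([_])

ℕ→ℚ : ℕ → ℚ
ℕ→ℚ k = mkℚ (+ k) 0 (coprime-sym (1-coprimeTo k))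

ℕ→ℚ-mono-< : ∀ {k m} → k < m → ℕ→ℚ k <ℚ ℕ→ℚ m
ℕ→ℚ-mono-< {k} {m} k<m =
  *<* (subst₂ ℤ._<_ (sym (ℤ.*-identityʳ (+ k))) (sym (ℤ.*-identityʳ (+ m))) (ℤ.+<+ k<m))

ℕ→ℚ-cancel-< : ∀ {k m} → ℕ→ℚ k <ℚ ℕ→ℚ m → k < m
ℕ→ℚ-cancel-< {k} {m} (*<* k<m) =
  ℤ.drop‿+<+ (subst₂ ℤ._<_ (ℤ.*-identityʳ (+ k)) (ℤ.*-identityʳ (+ m)) k<m)

record VetoIntervalℕ : Set where
  constructor vetoℕ
  field
    l v r : ℕ
    l<v   : l < v
    v<r   : v < r
open VetoIntervalℕ

Crosses : VetoIntervalℕ → VetoIntervalℕ → Set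
Crosses A B = v A < l B × l B < r A × r A < v B

VetoAdjℕ : VetoIntervalℕ → VetoIntervalℕ → Set
VetoAdjℕ A B = Crosses A B ⊎ Crosses B A

VetoAdjℕ-irrefl : ∀ {A} → ¬ VetoAdjℕ A A
VetoAdjℕ-irrefl {A} (inj₁ (vA<lA , _)) = <-asym (l<v A) vA<lA
VetoAdjℕ-irrefl {A} (inj₂ (vA<lA , _)) = <-asym (l<v A) vA<lA

crosses-tight : ∀ A B → v B ≡ 2 + l B → Crosses A B → r A ≡ 1 + l B
crosses-tight A B eq (_ , lB<rA , rA<vB) = ≤-antisym (s≤s⁻¹ (subst (r A <_) eq rA<vB)) lB<rA

IsVetoRepresentationℕ : ∀ {n} → Graph n → (Fin n → VetoIntervalℕ) → Set
IsVetoRepresentationℕ G J =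
  ∀ a b → a ≢ b → (Adj G a b → VetoAdjℕ (J a) (J b)) × (VetoAdjℕ (J a) (J b) → Adj G a b)

toVetoInterval : VetoIntervalℕ → VetoInterval
toVetoInterval A = veto (ℕ→ℚ (l A)) (ℕ→ℚ (v A)) (ℕ→ℚ (r A)) (ℕ→ℚ-mono-< (l<v A)) (ℕ→ℚ-mono-< (v<r A))

VetoAdjℕ⇒VetoAdj : ∀ {A B} → VetoAdjℕ A B → VetoAdj (toVetoInterval A) (toVetoInterval B)
VetoAdjℕ⇒VetoAdj (inj₁ (p , q , s)) = inj₁ (ℕ→ℚ-mono-< p , ℕ→ℚ-mono-< q , ℕ→ℚ-mono-< s)
VetoAdjℕ⇒VetoAdj (inj₂ (p , q , s)) = inj₂ (ℕ→ℚ-mono-< p , ℕ→ℚ-mono-< q , ℕ→ℚ-mono-< s)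

VetoAdj⇒VetoAdjℕ : ∀ {A B} → VetoAdj (toVetoInterval A) (toVetoInterval B) → VetoAdjℕ A B
VetoAdj⇒VetoAdjℕ (inj₁ (p , q , s)) = inj₁ (ℕ→ℚ-cancel-< p , ℕ→ℚ-cancel-< q , ℕ→ℚ-cancel-< s)
VetoAdj⇒VetoAdjℕ (inj₂ (p , q , s)) = inj₂ (ℕ→ℚ-cancel-< p , ℕ→ℚ-cancel-< q , ℕ→ℚ-cancel-< s)

IsVetoRepresentationℕ⇒IsVIGraph : ∀ {n} (G : Graph n) (J : Fin n → VetoIntervalℕ) →
  IsVetoRepresentationℕ G J → IsVIGraph G
IsVetoRepresentationℕ⇒IsVIGraph G J rep = toVetoInterval ∘ J , λ a b a≢b →
  let to , from = rep a b a≢b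
  in VetoAdjℕ⇒VetoAdj {J a} {J b} ∘ to , from ∘ VetoAdj⇒VetoAdjℕ {J a} {J b}

first second : VetoIntervalℕ
first  = vetoℕ 0 1 3 z<s (s≤s z<s)
second = vetoℕ 2 4 5 (s≤s (s≤s z<s)) (s≤s (s≤s (s≤s (s≤s z<s))))

first-crosses-second : Crosses first second
first-crosses-second = s≤s z<s , s≤s (s≤s z<s) , s≤s (s≤s (s≤s z<s))

side : ∀ {P : Set} → Dec P → VetoIntervalℕ
side (yes _) = first
side (no _)  = second

module _ (m k : ℕ) where

  bipartite-interval : Fin (m + k) → VetoIntervalℕ
  bipartite-interval a = side (toℕ a <? m)

  bipartite-representation : IsVetoRepresentationℕ (CompleteBipartite m k) bipartite-interval
  bipartite-representation a b _ = to , from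
    where
    to : KAdj m k a b → VetoAdjℕ (bipartite-interval a) (bipartite-interval b)
    to adj with toℕ a <? m | toℕ b <? m | adj
    ... | yes a<m | no b≮m | _                = inj₁ first-crosses-second
    ... | no a≮m  | yes b<m | _               = inj₂ first-crosses-second
    ... | yes _   | yes b<m | inj₁ (_ , m≤b)  = contradiction b<m (≤⇒≯ m≤b)
    ... | yes a<m | yes _   | inj₂ (_ , m≤a)  = contradiction a<m (≤⇒≯ m≤a)
    ... | no a≮m  | no _    | inj₁ (a<m , _)  = contradiction a<m a≮m
    ... | no _    | no b≮m  | inj₂ (b<m , _)  = contradiction b<m b≮m
    from : VetoAdjℕ (bipartite-interval a) (bipartite-interval b) → KAdj m k a b
    from adj with toℕ a <? m | toℕ b <? m
    ... | yes a<m | no b≮m = inj₁ (a<m , ≮⇒≥ b≮m)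
    ... | no a≮m  | yes b<m = inj₂ (b<m , ≮⇒≥ a≮m)
    ... | yes _   | yes _   = ⊥-elim (VetoAdjℕ-irrefl {first} adj)
    ... | no _    | no _    = ⊥-elim (VetoAdjℕ-irrefl {second} adj)

module _ (N : ℕ) where

  arc : ℕ → VetoIntervalℕ
  arc zero    = vetoℕ 7 10 (1 + (3 + N) * 4) (m<n+m 7 {3} z<s) (m≤m+n 11 (2 + N * 4))
  arc (suc i) = vetoℕ (suc i * 4) (2 + suc i * 4) (5 + suc i * 4)
    (m<n+m (suc i * 4) {2} z<s) (m<n+m (2 + suc i * 4) {3} z<s)

  arc-next : ∀ i → VetoAdjℕ (arc i) (arc (suc i))
  arc-next zero    = inj₂ (m<n+m 6 {1} z<s , m<n+m 7 {2} z<s , m<n+m 9 {1} z<s)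
  arc-next (suc i) = inj₁ (m<n+m (6 + i * 4) {2} z<s , n<1+n (8 + i * 4) , n<1+n (9 + i * 4))

  arc-last : VetoAdjℕ (arc 0) (arc (3 + N))
  arc-last = inj₁ (m≤m+n 11 (1 + N * 4) , n<1+n (12 + N * 4) , n<1+n (13 + N * 4))

  arc-step : ∀ i j → Crosses (arc (suc i)) (arc (suc j)) → suc j ≡ suc (suc i)
  arc-step i j cross =
    *-cancelʳ-≡ (suc j) (suc (suc i)) 4
      (sym (suc-injective (crosses-tight (arc (suc i)) (arc (suc j)) refl cross)))

  arc-from-0 : ∀ j → Crosses (arc 0) (arc (suc j)) → suc j ≡ 3 + N
  arc-from-0 j cross =
    *-cancelʳ-≡ (suc j) (3 + N) 4 (sym (suc-injective (crosses-tight (arc 0) (arc (suc j)) refl cross)))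

  arc-to-0 : ∀ j → Crosses (arc (suc j)) (arc 0) → j ≡ 0
  arc-to-0 zero    _              = refl
  arc-to-0 (suc j) (vj<7 , _ , _) = contradiction vj<7 (≤⇒≯ (m≤m+n 7 (3 + j * 4)))

  Step : ℕ → ℕ → Set
  Step i j = j ≡ suc i ⊎ (i ≡ 0 × j ≡ 3 + N)

  step⇒adjacent : ∀ i j → Step i j → VetoAdjℕ (arc i) (arc j)
  step⇒adjacent i .(suc i) (inj₁ refl)          = arc-next i
  step⇒adjacent .0 .(3 + N) (inj₂ (refl , refl)) = arc-last

  adjacent⇒step : ∀ i j → i ≢ j → VetoAdjℕ (arc i) (arc j) → Step i j ⊎ Step j i
  adjacent⇒step zero    zero    0≢0 _        = contradiction refl 0≢0
  adjacent⇒step zero    (suc j) _   (inj₁ c) = inj₁ (inj₂ (refl , arc-from-0 j c))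
  adjacent⇒step zero    (suc j) _   (inj₂ c) = inj₁ (inj₁ (cong suc (arc-to-0 j c)))
  adjacent⇒step (suc i) zero    _   (inj₁ c) = inj₂ (inj₁ (cong suc (arc-to-0 i c)))
  adjacent⇒step (suc i) zero    _   (inj₂ c) = inj₂ (inj₂ (refl , arc-from-0 i c))
  adjacent⇒step (suc i) (suc j) _   (inj₁ c) = inj₁ (inj₁ (arc-step i j c))
  adjacent⇒step (suc i) (suc j) _   (inj₂ c) = inj₂ (inj₁ (arc-step j i c))

  cycle-representation : IsVetoRepresentationℕ (Cycle (4 + N)) (arc ∘ toℕ)
  cycle-representation a b a≢b = to , from
    where
    to : CAdj (4 + N) a b → VetoAdjℕ (arc (toℕ a)) (arc (toℕ b))
    to (_ , inj₁ st) = step⇒adjacent (toℕ a) (toℕ b) st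
    to (_ , inj₂ st) = swap (step⇒adjacent (toℕ b) (toℕ a) st)
    from : VetoAdjℕ (arc (toℕ a)) (arc (toℕ b)) → CAdj (4 + N) a b
    from adj = a≢b , adjacent⇒step (toℕ a) (toℕ b) (a≢b ∘ toℕ-injective) adj

module _ {A : Set} {R : Rel A 0ℓ} where

  vertices : ∀ {a b} → Star R a b → List A
  vertices {a} ε       = [ a ]
  vertices {a} (_ ◅ p) = a ∷ vertices p

  vertices-nonempty : ∀ {a b} (p : Star R a b) → 1 ≤ length (vertices p)
  vertices-nonempty ε       = s≤s z≤n
  vertices-nonempty (_ ◅ _) = s≤s z≤n

  SimplePath : A → A → Set
  SimplePath a b = Σ (Star R a b) (Unique ∘ vertices)

  module _ (_≟_ : DecidableEquality A) where
    open import Data.List.Membership.DecPropositional _≟_ using (_∈?_)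

    simplePath-suffix : ∀ {x a b} (p : Star R a b) → x ∈ vertices p → Unique (vertices p) → SimplePath x b
    simplePath-suffix ε           (here refl)  u                = ε , u
    simplePath-suffix p@(_ ◅ _)   (here refl)  u                = p , u
    simplePath-suffix (_ ◅ p)     (there x∈p)  (_ AllPairs.∷ u) = simplePath-suffix p x∈p u

    erase-loops : ∀ {a b} → Star R a b → SimplePath a b
    erase-loops ε = ε , All.[] AllPairs.∷ AllPairs.[]
    erase-loops {a} (r ◅ p) with erase-loops p
    ... | q , uq with a ∈? vertices q
    ... | yes a∈q = simplePath-suffix q a∈q uq
    ... | no  a∉q = r ◅ q , ¬Any⇒All¬ (vertices q) a∉q AllPairs.∷ uq

module _ {n} (G : Graph n) {R : Rel (Fin n) 0ℓ} (R⇒Adj : ∀ {x y} → R x y → Adj G x y) where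

  linked-closing : ∀ {x y z} (p : Star R x y) → Adj G y z → Linked G (vertices p ++ [ z ])
  linked-closing ε                y~z = y~z , tt
  linked-closing (r ◅ ε)          y~z = R⇒Adj r , y~z , tt
  linked-closing (r ◅ p@(_ ◅ _))  y~z = R⇒Adj r , linked-closing p y~z

  -- After erasing loops, a path of two or more steps closes with the edge into a cycle.
  acyclic-edge-is-step : ¬ HasCycle G → ∀ {a b} → Star R a b → Adj G a b → R a b
  acyclic-edge-is-step acyclic p a~b with erase-loops _≟ᶠ_ p
  ... | ε , _              = contradiction a~b (irrefl G)
  ... | r ◅ ε , _          = r
  ... | r ◅ r′ ◅ q , uniq  = contradiction
    (_ , vertices (r′ ◅ q) , s≤s (vertices-nonempty q) , uniq , linked-closing (r ◅ r′ ◅ q) (symAdj G a~b))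
    acyclic

module _ {n} (G : Graph n) (root : Fin n) where

  Attached : (Fin n → Bool) → (Fin n → Fin n) → (Fin n → ℕ) → Fin n → Set
  Attached member parent depth y =
    member (parent y) ≡ true × depth y ≡ suc (depth (parent y)) × Adj G (parent y) y

  record PartialTree : Set where
    field
      member      : Fin n → Bool
      parent      : Fin n → Fin n
      depth       : Fin n → ℕ
      member-root : member root ≡ true
      depth-root  : depth root ≡ 0
      attached    : ∀ {y} → member y ≡ true → y ≢ root → Attached member parent depth y
  open PartialTree

  Spanning : PartialTree → Set
  Spanning T = ∀ y → member T y ≡ true

  _⊑_ : PartialTree → PartialTree → Set
  T ⊑ T′ = ∀ {y} → member T y ≡ true → member T′ y ≡ true

  member-≢ : ∀ (T : PartialTree) {x y} → member T x ≡ true → member T y ≡ false → x ≢ y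
  member-≢ T x∈T y∉T refl with () ← trans (sym x∈T) y∉T

  singleton : PartialTree
  singleton = record
    { member      = updateAt (const false) root (const true)
    ; parent      = id
    ; depth       = const 0
    ; member-root = updateAt-updates root (const false)
    ; depth-root  = refl
    ; attached    = λ {y} y∈ y≢root →
        contradiction (trans (sym (updateAt-minimal y root (const false) y≢root)) y∈) λ ()
    }

  graft : ∀ (T : PartialTree) {u w} → member T u ≡ true → member T w ≡ false → Adj G u w → PartialTree
  graft T {u} {w} u∈T w∉T u~w = record
    { member      = member′
    ; parent      = parent′
    ; depth       = depth′
    ; member-root = trans (updateAt-minimal root w (member T) root≢w) (member-root T)
    ; depth-root  = trans (updateAt-minimal root w (depth T) root≢w) (depth-root T)
    ; attached    = attached′
    }
    where
    member′ = updateAt (member T) w (const true)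
    parent′ = updateAt (parent T) w (const u)
    depth′  = updateAt (depth T) w (const (suc (depth T u)))
    root≢w = member-≢ T (member-root T) w∉T
    u≢w    = member-≢ T u∈T w∉T

    attached-w : Attached member′ parent′ depth′ w
    attached-w = member-u , depth-w , subst (λ p → Adj G p w) (sym parent-w) u~w
      where
      parent-w : parent′ w ≡ u
      parent-w = updateAt-updates w (parent T)
      member-u : member′ (parent′ w) ≡ true
      member-u = trans (cong member′ parent-w) (trans (updateAt-minimal u w (member T) u≢w) u∈T)
      depth-w : depth′ w ≡ suc (depth′ (parent′ w))
      depth-w = begin
        depth′ w                  ≡⟨ updateAt-updates w (depth T) ⟩
        suc (depth T u)           ≡⟨ cong suc (updateAt-minimal u w (depth T) u≢w) ⟨
        suc (depth′ u)            ≡⟨ cong (suc ∘ depth′) parent-w ⟨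
        suc (depth′ (parent′ w))  ∎
        where open ≡-Reasoning

    attached-old : ∀ {y} → y ≢ w → Attached (member T) (parent T) (depth T) y → Attached member′ parent′ depth′ y
    attached-old {y} y≢w (p∈T , depth-y , p~y) = member-p , depth-y′ , subst (λ p → Adj G p y) (sym parent-y) p~y
      where
      parent-y : parent′ y ≡ parent T y
      parent-y = updateAt-minimal y w (parent T) y≢w
      p≢w : parent T y ≢ w
      p≢w = member-≢ T p∈T w∉T
      member-p : member′ (parent′ y) ≡ true
      member-p = trans (cong member′ parent-y) (trans (updateAt-minimal _ w (member T) p≢w) p∈T)
      depth-y′ : depth′ y ≡ suc (depth′ (parent′ y))
      depth-y′ = begin
        depth′ y                    ≡⟨ updateAt-minimal y w (depth T) y≢w ⟩
        depth T y                   ≡⟨ depth-y ⟩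
        suc (depth T (parent T y))  ≡⟨ cong suc (updateAt-minimal _ w (depth T) p≢w) ⟨
        suc (depth′ (parent T y))   ≡⟨ cong (suc ∘ depth′) parent-y ⟨
        suc (depth′ (parent′ y))    ∎
        where open ≡-Reasoning

    attached′ : ∀ {y} → member′ y ≡ true → y ≢ root → Attached member′ parent′ depth′ y
    attached′ {y} y∈T′ y≢root with y ≟ᶠ w
    ... | yes refl = attached-w
    ... | no y≢w   =
      attached-old y≢w (attached T (trans (sym (updateAt-minimal y w (member T) y≢w)) y∈T′) y≢root)

  ⊑-graft : ∀ T {u w} (u∈T : member T u ≡ true) (w∉T : member T w ≡ false) (u~w : Adj G u w) →
    T ⊑ graft T u∈T w∉T u~w
  ⊑-graft T {w = w} _ _ _ {y} y∈T with y ≟ᶠ w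
  ... | yes refl = updateAt-updates w (member T)
  ... | no y≢w   = trans (updateAt-minimal y w (member T) y≢w) y∈T

  grow-along : ∀ (T : PartialTree) {u x} → member T u ≡ true → Walk G u x →
    Σ PartialTree λ T′ → T ⊑ T′ × member T′ x ≡ true
  grow-along T u∈T stop = T , id , u∈T
  grow-along T u∈T (step {b = w} u~w walk) with member T w in w-status
  ... | true  = grow-along T w-status walk
  ... | false with grow-along (graft T u∈T w-status u~w) (updateAt-updates w (member T)) walk
  ...   | T′ , T⊑T′ , x∈T′ = T′ , (λ y∈T → T⊑T′ (⊑-graft T u∈T w-status u~w y∈T)) , x∈T′

  cover : Connected G → (xs : List (Fin n)) → Σ PartialTree λ T → All.All (λ y → member T y ≡ true) xs
  cover conn []       = singleton , All.[]
  cover conn (x ∷ xs) with cover conn xs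
  ... | T , xs⊆T with grow-along T (member-root T) (conn root x)
  ...   | T′ , T⊑T′ , x∈T′ = T′ , x∈T′ All.∷ All.map T⊑T′ xs⊆T

  spanningTree : Connected G → Σ PartialTree Spanning
  spanningTree conn with cover conn (allFin n)
  ... | T , all⊆T = T , λ y → All.lookup all⊆T (∈-allFin y)

radix-≤ : ∀ {K u w x y} → w < K → u + x * K ≤ w + y * K → x ≤ y
radix-≤ {K} {u} {w} {x} {y} w<K le with x ≤? y
... | yes x≤y = x≤y
... | no  x≰y = contradiction le (<⇒≱ (begin-strict
  w + y * K  <⟨ +-monoˡ-< (y * K) w<K ⟩
  suc y * K  ≤⟨ *-monoˡ-≤ K (≰⇒> x≰y) ⟩
  x * K      ≤⟨ m≤n+m (x * K) u ⟩
  u + x * K  ∎))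
  where open ≤-Reasoning

radix-injective : ∀ {K u w x y} → u < K → w < K → u + x * K ≡ w + y * K → u ≡ w × x ≡ y
radix-injective {K} {u} {w} {x} {y} u<K w<K eq =
  +-cancelʳ-≡ (y * K) u w (subst (λ z → u + z * K ≡ w + y * K) x≡y eq) , x≡y
  where
  x≡y : x ≡ y
  x≡y = ≤-antisym (radix-≤ w<K (≤-reflexive eq)) (radix-≤ u<K (≤-reflexive (sym eq)))

module TreeIntervals {n} {G : Graph n} {root : Fin n} (T : PartialTree G root) (spans : Spanning G root T) where
  open PartialTree T

  depth-parent : ∀ {x} → x ≢ root → depth x ≡ suc (depth (parent x))
  depth-parent x≢root = proj₁ (proj₂ (attached (spans _) x≢root))

  parent-adj : ∀ {x} → x ≢ root → Adj G (parent x) x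
  parent-adj x≢root = proj₂ (proj₂ (attached (spans _) x≢root))

  ParentEdge : Fin n → Fin n → Set
  ParentEdge p c = c ≢ root × parent c ≡ p

  TreeEdge : Rel (Fin n) 0ℓ
  TreeEdge x y = ParentEdge x y ⊎ ParentEdge y x

  TreeEdge⇒Adj : ∀ {x y} → TreeEdge x y → Adj G x y
  TreeEdge⇒Adj (inj₁ (y≢root , refl)) = parent-adj y≢root
  TreeEdge⇒Adj (inj₂ (x≢root , refl)) = symAdj G (parent-adj x≢root)

  path-to-root : ∀ x → Star TreeEdge x root
  path-to-root x = climb (depth x) x refl
    where
    climb : ∀ d x → depth x ≡ d → Star TreeEdge x root
    climb d x _ with x ≟ᶠ root
    climb d       x _      | yes refl = ε
    climb zero    x dx≡0   | no x≢root with () ← trans (sym dx≡0) (depth-parent x≢root)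
    climb (suc d) x dx≡1+d | no x≢root =
      inj₂ (x≢root , refl) ◅ climb d (parent x) (suc-injective (trans (sym (depth-parent x≢root)) dx≡1+d))

  edge⇒TreeEdge : ¬ HasCycle G → ∀ {a b} → Adj G a b → TreeEdge a b
  edge⇒TreeEdge acyclic {a} {b} =
    acyclic-edge-is-step G TreeEdge⇒Adj acyclic (path-to-root a ◅◅ reverse swap (path-to-root b))

  K : ℕ
  K = n * 3

  digit<K : ∀ (x : Fin n) → 2 + toℕ x * 3 < K
  digit<K x = *-monoˡ-≤ 3 (toℕ<n x)

  level : (p x : Fin n) (d : ℕ) → VetoIntervalℕ
  level p x d = vetoℕ (toℕ p * 3 + d * K) (2 + toℕ p * 3 + d * K) (1 + toℕ x * 3 + suc d * K)
    (+-monoˡ-< (d * K) (m<n+m (toℕ p * 3) {2} z<s))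
    (<-≤-trans (+-monoˡ-< (d * K) (digit<K p)) (m≤n+m (suc d * K) (1 + toℕ x * 3)))

  interval : Fin n → VetoIntervalℕ
  interval x = level (parent x) x (depth x)

  level-child : ∀ p a b d → Crosses (level p a d) (level a b (suc d))
  level-child p a b d =
      <-≤-trans (+-monoˡ-< (d * K) (digit<K p)) (m≤n+m (suc d * K) (toℕ a * 3))
    , n<1+n (toℕ a * 3 + suc d * K)
    , n<1+n (1 + toℕ a * 3 + suc d * K)

  parentEdge⇒crosses : ∀ {a b} → ParentEdge a b → Crosses (interval a) (interval b)
  parentEdge⇒crosses {b = b} (b≢root , refl) =
    subst (λ d → Crosses (interval (parent b)) (level (parent b) b d))
      (sym (depth-parent b≢root)) (level-child (parent (parent b)) (parent b) b (depth (parent b)))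

  crosses⇒parentEdge : ∀ {a b} → Crosses (interval a) (interval b) → ParentEdge a b
  crosses⇒parentEdge {a} {b} cross = b≢root , toℕ-injective (*-cancelʳ-≡ _ _ 3 (sym (proj₁ digits)))
    where
    right-end-next : toℕ a * 3 + suc (depth a) * K ≡ toℕ (parent b) * 3 + depth b * K
    right-end-next = suc-injective (crosses-tight (interval a) (interval b) refl cross)
    digits : toℕ a * 3 ≡ toℕ (parent b) * 3 × suc (depth a) ≡ depth b
    digits = radix-injective {K} (≤-<-trans (m≤n+m _ 2) (digit<K a))
                                 (≤-<-trans (m≤n+m _ 2) (digit<K (parent b))) right-end-next
    b≢root : b ≢ root
    b≢root refl with () ← trans (proj₂ digits) depth-root

  tree-representation : ¬ HasCycle G → IsVetoRepresentationℕ G interval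
  tree-representation acyclic a b _ =
      (Sum.map parentEdge⇒crosses parentEdge⇒crosses ∘ edge⇒TreeEdge acyclic)
    , (TreeEdge⇒Adj ∘ Sum.map crosses⇒parentEdge crosses⇒parentEdge)

bipartite⇒IsVIGraph : ∀ m k → IsVIGraph (CompleteBipartite m k)
bipartite⇒IsVIGraph m k =
  IsVetoRepresentationℕ⇒IsVIGraph (CompleteBipartite m k) (bipartite-interval m k) (bipartite-representation m k)

cycle⇒IsVIGraph : ∀ n → 4 ≤ n → IsVIGraph (Cycle n)
cycle⇒IsVIGraph _ (s≤s (s≤s (s≤s (s≤s {n = N} z≤n)))) =
  IsVetoRepresentationℕ⇒IsVIGraph (Cycle (4 + N)) (arc N ∘ toℕ) (cycle-representation N)

tree⇒IsVIGraph : ∀ n (T : Graph n) → IsTree T → IsVIGraph T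
tree⇒IsVIGraph zero    T _                = (λ ()) , λ ()
tree⇒IsVIGraph (suc n) T (conn , acyclic) with spanningTree T fzero conn
... | S , spans = IsVetoRepresentationℕ⇒IsVIGraph T interval (tree-representation acyclic)
  where open TreeIntervals S spans

-- K_{0,k} and K_{m,0} are edgeless.
proposition6 :
    (∀ (m k : ℕ) → 1 ≤ m → 1 ≤ k → IsVIGraph (CompleteBipartite m k))
    × (∀ (n : ℕ) → 4 ≤ n → IsVIGraph (Cycle n))
    × (∀ (n : ℕ) (T : Graph n) → IsTree T → IsVIGraph T)
proposition6 = (λ m k _ _ → bipartite⇒IsVIGraph m k) , cycle⇒IsVIGraph , tree⇒IsVIGraph
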